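{- Let $J$ be the graph with vertex set $\{X_1,X_2,X_3,Y_4,Y_5,Y_6,Y_7,Y_8\}$ and edge set $\{X_1Y_4,\ Y_4Y_5,\ Y_5Y_7,\ Y_7Y_8,\ Y_6Y_8,\ Y_4Y_6,\ X_2Y_5,\ X_2Y_8,\ X_3Y_6,\ X_3Y_7\}$. Let $X$ be a subset of $\{X_1,X_2,X_3\}$ containing at most two vertices. Then there exists a near-bipartite decomposition $(A,B)$ of $J$ such that, for every $p\in\{1,2,3\}$, $X_p\in A$ if and only if $X_p\in X$.
   Context: A near-bipartite decomposition of a graph $G=(V,E)$ is a partition $(A,B)$ of $V$ such that $A$ is an independent set and the subgraph induced by $B$ is a forest. -}

module Defs where

open import Data.Bool using (Bool; true; false)
open import Data.Nat using (ℕ; _≥_)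
open import Data.List using (List; []; _∷_; length; head; last)
open import Data.List.Relation.Unary.Unique.Propositional using (Unique)
open import Data.Maybe using (Maybe; just)
open import Data.Product using (_×_; Σ; ∃; _,_)
open import Data.Empty using (⊥)
open import Data.Sum using (_⊎_)
open import Data.Fin using (Fin; zero; suc)
open import Relation.Nullary using (¬_)
open import Relation.Binary.PropositionalEquality using (_≡_)

data Path {V : Set} (Adj : V → V → Set) : List V → Set where
  []  : Path Adj []
  [_] : ∀ v → Path Adj (v ∷ [])
  _∷_ : ∀ {u v vs} → Adj u v → Path Adj (v ∷ vs) → Path Adj (u ∷ v ∷ vs)

Induced : {V : Set} → (V → V → Set) → (V → Set) → V → V → Set
Induced Adj S u v = S u × S v × Adj u v

IsCycle : {V : Set} → (V → V → Set) → List V → Set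
IsCycle {V} Adj [] = ⊥
IsCycle {V} Adj (v ∷ vs) =
  length (v ∷ vs) ≥ 3 × Unique (v ∷ vs) × Path Adj (v ∷ vs) ×
  Σ V (λ w → last (v ∷ vs) ≡ just w × Adj w v)

IsForest : {V : Set} → (V → V → Set) → Set
IsForest {V} Adj = ∀ (c : List V) → ¬ IsCycle Adj c

IsIndependent : {V : Set} → (V → V → Set) → (V → Set) → Set
IsIndependent {V} Adj S = ∀ (u v : V) → S u → S v → ¬ Adj u v

-- A partition (A, B) of V is encoded by its indicator inA : V → Bool
-- (A = {v | inA v ≡ true}, B = {v | inA v ≡ false}).
InA InB : {V : Set} → (V → Bool) → V → Set
InA inA v = inA v ≡ true
InB inA v = inA v ≡ false

IsNearBipartite : {V : Set} → (V → V → Set) → (V → Bool) → Set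
IsNearBipartite Adj inA =
  IsIndependent Adj (InA inA) × IsForest (Induced Adj (InB inA))

data JV : Set where
  X₁ X₂ X₃ Y₄ Y₅ Y₆ Y₇ Y₈ : JV

data JEdge : JV → JV → Set where
  e14 : JEdge X₁ Y₄
  e45 : JEdge Y₄ Y₅
  e57 : JEdge Y₅ Y₇
  e78 : JEdge Y₇ Y₈
  e68 : JEdge Y₆ Y₈
  e46 : JEdge Y₄ Y₆
  e25 : JEdge X₂ Y₅
  e28 : JEdge X₂ Y₈
  e36 : JEdge X₃ Y₆
  e37 : JEdge X₃ Y₇

JAdj : JV → JV → Set
JAdj u v = JEdge u v ⊎ JEdge v u

-- The vertices X₁, X₂, X₃ indexed by p ∈ {1,2,3} (as Fin 3).
Xv : Fin 3 → JV
Xv zero = X₁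
Xv (suc zero) = X₂
Xv (suc (suc zero)) = X₃

module Submission where

-- For each admissible X ⊆ {X₁, X₂, X₃} we exhibit an explicit
-- decomposition (A, B) of J, given by the list of vertices of A together with a
-- parent pointer for each non-root vertex of a spanning forest of J[B].
--
-- The one piece of genuine graph theory is a forest criterion (module
-- RankedParents): if every edge of a graph joins a vertex to its parent, and
-- parents have strictly smaller rank than their children, the graph has no
-- cycle.  Along a walk without backtracking, the edges first climb towards the
-- roots and, once they go down, keep going down; a cycle can do neither.
--
-- For J, "A independent, every edge of J[B] a parent edge, and A ∩ {X₁,X₂,X₃}
-- equals X" is a decidable property of a witness (with the rank taken to be
-- the depth in the parent forest).  It is verified by evaluation for each of
-- the seven subsets X, and the forest criterion turns it into the theorem.

open import Defs
open import Data.Bool using (Bool; true; false; if_then_else_)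
import Data.Bool.Properties as Bool
open import Data.Nat using (ℕ; zero; suc; _≤_; _<_; s≤s)
import Data.Nat.Properties as ℕ
open import Data.Fin using (Fin)
import Data.Fin.Properties as Fin
open import Data.Fin.Subset using (Subset; _∈_; ∣_∣)
open import Data.Product using (Σ; _×_; _,_; proj₁; proj₂; uncurry)
open import Data.Sum using (_⊎_; inj₁; inj₂; swap)
open import Data.Maybe using (Maybe; just; nothing)
open import Data.Maybe.Properties as Maybe using (just-injective)
open import Data.List using (List; []; _∷_; last)
open import Data.List.Relation.Unary.Any using (here; there)
open import Data.List.Membership.Propositional using () renaming (_∈_ to _∈ₗ_)
import Data.List.Relation.Unary.All as All
open import Data.List.Relation.Unary.All using (All)
open import Data.List.Relation.Unary.AllPairs using (_∷_)
open import Data.List.Relation.Unary.Unique.Propositional using (Unique)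
open import Data.Vec using ([]; _∷_; lookup)
open import Data.Vec.Properties using (lookup⇒[]=; []=⇒lookup)
open import Data.Unit using (⊤; tt)
open import Data.Empty using (⊥-elim)
open import Relation.Nullary using (¬_; Dec; does; map′; ¬?; _×-dec_; _⊎-dec_; _→-dec_)
open import Relation.Nullary.Decidable using (True; toWitness)
open import Relation.Binary.Definitions using (DecidableEquality)
open import Relation.Binary.PropositionalEquality using (_≡_; _≢_; refl; sym; trans; cong)
open import Function.Bundles using (_⇔_; mk⇔)

end : {V : Set} → V → List V → V
end v []       = v
end _ (w ∷ ws) = end w ws

penult : {V : Set} → V → V → List V → V
penult u _ []       = u
penult _ v (w ∷ ws) = penult v w ws

last≡end : {V : Set} (v : V) (vs : List V) → last (v ∷ vs) ≡ just (end v vs)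
last≡end v []       = refl
last≡end v (w ∷ ws) = last≡end w ws

end∈ : {V : Set} (v : V) (vs : List V) → end v vs ∈ₗ v ∷ vs
end∈ v []       = here refl
end∈ v (w ∷ ws) = there (end∈ w ws)

penult∈ : {V : Set} (u v : V) (vs : List V) → penult u v vs ∈ₗ u ∷ v ∷ vs
penult∈ u v []       = here refl
penult∈ u v (w ∷ ws) = there (penult∈ v w ws)

NoBacktrack : {V : Set} → List V → Set
NoBacktrack (u ∷ v ∷ w ∷ ws) = u ≢ w × NoBacktrack (v ∷ w ∷ ws)
NoBacktrack _                = ⊤

unique⇒noBacktrack : {V : Set} {vs : List V} → Unique vs → NoBacktrack vs
unique⇒noBacktrack {vs = []}                 _ = tt
unique⇒noBacktrack {vs = _ ∷ []}             _ = tt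
unique⇒noBacktrack {vs = _ ∷ _ ∷ []}         _ = tt
unique⇒noBacktrack {vs = _ ∷ _ ∷ _ ∷ _} ((_ All.∷ u≢w All.∷ _) ∷ distinct) =
  u≢w , unique⇒noBacktrack distinct

module RankedParents {V : Set} (par : V → Maybe V) (rk : V → ℕ) where

  Up : V → V → Set
  Up u v = par u ≡ just v × rk v < rk u

  up-functional : ∀ {u v w} → Up u v → Up u w → v ≡ w
  up-functional (pv , _) (pw , _) = just-injective (trans (sym pv) pw)

  data Descending : List V → Set where
    [_] : ∀ v → Descending (v ∷ [])
    _∷_ : ∀ {u v vs} → Up v u → Descending (v ∷ vs) → Descending (u ∷ v ∷ vs)

  descending-rank : ∀ {u v vs} → Descending (u ∷ v ∷ vs) → rk u < rk (end v vs)
  descending-rank (vu ∷ [ _ ])         = proj₂ vu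
  descending-rank (vu ∷ down@(_ ∷ _))  = ℕ.<-trans (proj₂ vu) (descending-rank down)

  descending-last : ∀ {u v vs} → Descending (u ∷ v ∷ vs) → Up (end v vs) (penult u v vs)
  descending-last (vu ∷ [ _ ])        = vu
  descending-last (_ ∷ down@(_ ∷ _))  = descending-last down

  module _ {R : V → V → Set} (orient : ∀ {u v} → R u v → Up u v ⊎ Up v u) where

    -- Once a walk without backtracking goes down, it keeps going down: the
    -- other choice would give the current vertex two different parents.
    descends : ∀ {u v vs} → Up v u → Path R (v ∷ vs) → NoBacktrack (u ∷ v ∷ vs) →
               Descending (u ∷ v ∷ vs)
    descends {vs = []}    vu [ _ ]    _          = vu ∷ [ _ ]
    descends {vs = _ ∷ _} vu (r ∷ rs) (u≢w , nb) with orient r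
    ... | inj₁ vw = ⊥-elim (u≢w (up-functional vu vw))
    ... | inj₂ wv = vu ∷ descends wv rs nb

    climbs-or-ends-down : ∀ {u v vs} → Path R (u ∷ v ∷ vs) → NoBacktrack (u ∷ v ∷ vs) →
                          rk (end v vs) < rk u ⊎ Up (end v vs) (penult u v vs)
    climbs-or-ends-down (r ∷ rs) nb with orient r
    climbs-or-ends-down (r ∷ rs) nb | inj₂ vu = inj₂ (descending-last (descends vu rs nb))
    climbs-or-ends-down {vs = []}    (r ∷ rs) nb        | inj₁ uv = inj₁ (proj₂ uv)
    climbs-or-ends-down {vs = _ ∷ _} (r ∷ rs) (_ , nb)  | inj₁ uv
      with climbs-or-ends-down rs nb
    ... | inj₁ below = inj₁ (ℕ.<-trans below (proj₂ uv))
    ... | inj₂ down  = inj₂ down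

    -- Closing the cycle v₀ v₁ … z by the edge z v₀ is impossible: if z steps
    -- up to v₀, the walk v₀ … z must end by stepping down from z, giving z a
    -- second parent; if v₀ steps up to z, the walk z v₀ … z descends, so
    -- rk z < rk z.
    no-closing-edge : ∀ {v₀ v₁ v₂ vs} → Unique (v₀ ∷ v₁ ∷ v₂ ∷ vs) →
                      Path R (v₀ ∷ v₁ ∷ v₂ ∷ vs) → ¬ R (end v₂ vs) v₀
    no-closing-edge distinct walk closing with orient closing
    no-closing-edge {v₁ = v₁} {v₂} {vs} distinct@((v₀∉ ∷ _)) walk _ | inj₁ zv₀
      with climbs-or-ends-down walk (unique⇒noBacktrack distinct)
    ... | inj₁ below = ℕ.<-asym below (proj₂ zv₀)
    ... | inj₂ down  = All.lookup v₀∉ (penult∈ v₁ v₂ vs) (up-functional zv₀ down)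
    no-closing-edge {v₁ = v₁} {v₂} {vs} distinct@((_ ∷ (v₁∉ ∷ _))) walk _ | inj₂ v₀z =
      ℕ.<-irrefl refl (descending-rank (descends v₀z walk (z≢v₁ , unique⇒noBacktrack distinct)))
      where
      z≢v₁ : end v₂ vs ≢ v₁
      z≢v₁ z≡v₁ = All.lookup v₁∉ (end∈ v₂ vs) (sym z≡v₁)

    forest : IsForest R
    forest []                    ()
    forest (_ ∷ [])              (s≤s () , _)
    forest (_ ∷ _ ∷ [])          (s≤s (s≤s ()) , _)
    forest (v₀ ∷ v₁ ∷ v₂ ∷ vs) (_ , distinct , walk , z , lastz , closing)
      with just-injective (trans (sym lastz) (last≡end v₀ (v₁ ∷ v₂ ∷ vs)))
    ... | refl = no-closing-edge distinct walk closing

code : JV → ℕ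
code X₁ = 0
code X₂ = 1
code X₃ = 2
code Y₄ = 3
code Y₅ = 4
code Y₆ = 5
code Y₇ = 6
code Y₈ = 7

decode : ℕ → JV
decode 0 = X₁
decode 1 = X₂
decode 2 = X₃
decode 3 = Y₄
decode 4 = Y₅
decode 5 = Y₆
decode 6 = Y₇
decode _ = Y₈

decode-code : ∀ v → decode (code v) ≡ v
decode-code X₁ = refl
decode-code X₂ = refl
decode-code X₃ = refl
decode-code Y₄ = refl
decode-code Y₅ = refl
decode-code Y₆ = refl
decode-code Y₇ = refl
decode-code Y₈ = refl

code-injective : ∀ {u v} → code u ≡ code v → u ≡ v
code-injective {u} {v} eq = trans (sym (decode-code u)) (trans (cong decode eq) (decode-code v))

_≟ⱽ_ : DecidableEquality JV
u ≟ⱽ v = map′ code-injective (cong code) (code u ℕ.≟ code v)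

open import Data.List.Membership.DecPropositional _≟ⱽ_ using (_∈?_)

edges : List (JV × JV)
edges = (X₁ , Y₄) ∷ (Y₄ , Y₅) ∷ (Y₅ , Y₇) ∷ (Y₇ , Y₈) ∷ (Y₆ , Y₈) ∷
        (Y₄ , Y₆) ∷ (X₂ , Y₅) ∷ (X₂ , Y₈) ∷ (X₃ , Y₆) ∷ (X₃ , Y₇) ∷ []

edge∈ : ∀ {u v} → JEdge u v → (u , v) ∈ₗ edges
edge∈ e14 = here refl
edge∈ e45 = there (here refl)
edge∈ e57 = there (there (here refl))
edge∈ e78 = there (there (there (here refl)))
edge∈ e68 = there (there (there (there (here refl))))
edge∈ e46 = there (there (there (there (there (here refl)))))
edge∈ e25 = there (there (there (there (there (there (here refl))))))
edge∈ e28 = there (there (there (there (there (there (there (here refl)))))))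
edge∈ e36 = there (there (there (there (there (there (there (there (here refl))))))))
edge∈ e37 = there (there (there (there (there (there (there (there (there (here refl)))))))))

-- A candidate decomposition of J: the vertices of A, and for the non-root
-- vertices of a spanning forest of J[B] pairs (child , parent).
record Witness : Set where
  constructor witness
  field
    aSide       : List JV
    parentPairs : List (JV × JV)

  inA : JV → Bool
  inA v = does (v ∈? aSide)

  parent : JV → Maybe JV
  parent = lookupIn parentPairs
    where
    lookupIn : List (JV × JV) → JV → Maybe JV
    lookupIn []                _ = nothing
    lookupIn ((c , p) ∷ pairs) v = if does (c ≟ⱽ v) then just p else lookupIn pairs v

  -- The number of ancestors of a vertex: the rank certifying that the parent
  -- pointers are acyclic (a forest on the 8 vertices of J has fewer than 8 levels).
  depth : JV → ℕ
  depth = below 8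
    where
    below : ℕ → JV → ℕ
    below zero    _ = 0
    below (suc n) v with parent v
    ... | nothing = 0
    ... | just p  = suc (below n p)

module Checked (w : Witness) where
  open Witness w public
  open RankedParents parent depth public

  GoodEdge : JV → JV → Set
  GoodEdge u v = ¬ (InA inA u × InA inA v) × (InB inA u → InB inA v → Up u v ⊎ Up v u)

  goodEdge? : ∀ u v → Dec (GoodEdge u v)
  goodEdge? u v = ¬? (inA? u ×-dec inA? v) ×-dec (inB? u →-dec (inB? v →-dec (up? u v ⊎-dec up? v u)))
    where
    inA? : ∀ v → Dec (InA inA v)
    inB? : ∀ v → Dec (InB inA v)
    inA? v = inA v Bool.≟ true
    inB? v = inA v Bool.≟ false
    up? : ∀ u v → Dec (Up u v)
    up? u v = Maybe.≡-dec _≟ⱽ_ (parent u) (just v) ×-dec (depth v ℕ.<? depth u)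

  record Valid (X : Subset 3) : Set where
    constructor valid
    field
      goodEdges : All (uncurry GoodEdge) edges
      agreesOnX : ∀ p → inA (Xv p) ≡ lookup X p

  valid? : ∀ X → Dec (Valid X)
  valid? X = map′ (uncurry valid) (λ ok → Valid.goodEdges ok , Valid.agreesOnX ok)
    (All.all? (uncurry goodEdge?) edges ×-dec Fin.all? (λ p → inA (Xv p) Bool.≟ lookup X p))

  module _ {X : Subset 3} (ok : Valid X) where
    open Valid ok

    good : ∀ {u v} → JEdge u v → GoodEdge u v
    good e = All.lookup goodEdges (edge∈ e)

    independent : IsIndependent JAdj (InA inA)
    independent u v au av (inj₁ e) = proj₁ (good e) (au , av)
    independent u v au av (inj₂ e) = proj₁ (good e) (av , au)

    orient : ∀ {u v} → Induced JAdj (InB inA) u v → Up u v ⊎ Up v u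
    orient (bu , bv , inj₁ e) = proj₂ (good e) bu bv
    orient (bu , bv , inj₂ e) = swap (proj₂ (good e) bv bu)

    nearBipartite : IsNearBipartite JAdj inA
    nearBipartite = independent , forest orient

    agrees : (p : Fin 3) → InA inA (Xv p) ⇔ p ∈ X
    agrees p = mk⇔ (λ inAp → lookup⇒[]= p X (trans (sym (agreesOnX p)) inAp))
                   (λ p∈X → trans (agreesOnX p) ([]=⇒lookup p∈X))

certified : (X : Subset 3) (w : Witness) → {True (Checked.valid? w X)} →
            Σ Witness (λ w → Checked.Valid w X)
certified X w {checked} = w , toWitness checked

decomposition : (X : Subset 3) → ∣ X ∣ ≤ 2 → Σ Witness (λ w → Checked.Valid w X)
decomposition (false ∷ false ∷ false ∷ []) _ = certified _
  (witness (Y₄ ∷ Y₇ ∷ []) ((X₃ , Y₆) ∷ (Y₅ , X₂) ∷ (Y₆ , Y₈) ∷ (Y₈ , X₂) ∷ []))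
decomposition (false ∷ false ∷ true  ∷ []) _ = certified _
  (witness (X₃ ∷ Y₄ ∷ Y₈ ∷ []) ((Y₅ , X₂) ∷ (Y₇ , Y₅) ∷ []))
decomposition (false ∷ true  ∷ false ∷ []) _ = certified _
  (witness (X₂ ∷ Y₄ ∷ Y₇ ∷ []) ((Y₆ , X₃) ∷ (Y₈ , Y₆) ∷ []))
decomposition (false ∷ true  ∷ true  ∷ []) _ = certified _
  (witness (X₂ ∷ X₃ ∷ Y₄ ∷ []) ((Y₆ , Y₈) ∷ (Y₇ , Y₅) ∷ (Y₈ , Y₇) ∷ []))
decomposition (true  ∷ false ∷ false ∷ []) _ = certified _
  (witness (X₁ ∷ Y₅ ∷ Y₆ ∷ []) ((X₃ , Y₇) ∷ (Y₇ , Y₈) ∷ (Y₈ , X₂) ∷ []))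
decomposition (true  ∷ false ∷ true  ∷ []) _ = certified _
  (witness (X₁ ∷ X₃ ∷ Y₅ ∷ Y₈ ∷ []) ((Y₆ , Y₄) ∷ []))
decomposition (true  ∷ true  ∷ false ∷ []) _ = certified _
  (witness (X₁ ∷ X₂ ∷ Y₆ ∷ Y₇ ∷ []) ((Y₅ , Y₄) ∷ []))
decomposition (true  ∷ true  ∷ true  ∷ []) (s≤s (s≤s ()))

lemma3 : (X : Subset 3) → ∣ X ∣ ≤ 2 →
    Σ (JV → Bool) (λ inA →
      IsNearBipartite JAdj inA × ((p : Fin 3) → InA inA (Xv p) ⇔ p ∈ X))
lemma3 X ∣X∣≤2 with decomposition X ∣X∣≤2
... | w , ok = inA , nearBipartite ok , agrees ok
  where open Checked w
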